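{- Let $G=(V,E)$ be a connected undirected multigraph (parallel edges allowed, no loops), let $s,t\in V$ be distinct, and let $k,\ell$ be positive integers. Define $f,g:V\to\mathbb{N}$ by $f(v)=k$ and $g(v)=\ell$ for all $v\in V\setminus\{s,t\}$, and $f(s)=g(t)=0$, $g(s)=d(s)$, $f(t)=d(t)$. Then the following are equivalent: (i) $G$ has an acyclic orientation in which, for every vertex $v\in V\setminus\{s,t\}$, there are $k$ pairwise arc-disjoint directed paths from $s$ to $v$ and $\ell$ pairwise arc-disjoint directed paths from $v$ to $t$; (ii) $G$ has an acyclic orientation satisfying $f(v)\le \varrho(v)\le d(v)-g(v)$ for every $v\in V$.
   Context: $d(v)$ denotes the degree of $v$ in $G$ (counting parallel edges). In an orientation of $G$, $\varrho(v)$ denotes the indegree (number of incoming arcs) of $v$; the outdegree is $\delta(v)=d(v)-\varrho(v)$. An orientation is acyclic if it contains no directed cycle. -}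

module Defs where

open import Data.Nat using (ℕ; _≤_; _+_)
open import Data.Fin using (Fin)
open import Data.Fin.Properties using (_≟_)
open import Data.Bool using (Bool; if_then_else_)
open import Data.Product using (_×_; _,_; proj₁; proj₂; ∃)
open import Data.Sum using (_⊎_)
open import Data.List using (List; []; _∷_; length; filter; allFin)
open import Data.List.Membership.Propositional using (_∈_)
open import Data.List.Relation.Unary.Unique.Propositional using (Unique)
open import Relation.Binary.PropositionalEquality using (_≡_; _≢_)
open import Relation.Binary.Construct.Closure.ReflexiveTransitive using (Star)
open import Relation.Nullary using (¬_; _⊎-dec_)
open import Data.Empty using (⊥)

record MultiGraph (n m : ℕ) : Set where
  field
    ends     : Fin m → Fin n × Fin n
    loopless : ∀ e → proj₁ (ends e) ≢ proj₂ (ends e)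
open MultiGraph public

module _ {n m : ℕ} (G : MultiGraph n m) where

  Incident : Fin m → Fin n → Set
  Incident e v = proj₁ (ends G e) ≡ v ⊎ proj₂ (ends G e) ≡ v

  Adj : Fin n → Fin n → Set
  Adj u v = ∃ λ e → (ends G e ≡ (u , v)) ⊎ (ends G e ≡ (v , u))

  Connected : Set
  Connected = ∀ u v → Star Adj u v

  -- degree (no loops, so each incident edge counted once)
  deg : Fin n → ℕ
  deg v = length (filter (λ e → (proj₁ (ends G e) ≟ v) ⊎-dec (proj₂ (ends G e) ≟ v)) (allFin m))

-- An orientation: o e = true orients edge e from proj₁ to proj₂ of its ends,
-- o e = false orients it from proj₂ to proj₁.
Orientation : ℕ → Set
Orientation m = Fin m → Bool

module _ {n m : ℕ} (G : MultiGraph n m) (o : Orientation m) where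

  tail : Fin m → Fin n
  tail e = if o e then proj₁ (ends G e) else proj₂ (ends G e)

  head : Fin m → Fin n
  head e = if o e then proj₂ (ends G e) else proj₁ (ends G e)

  indeg : Fin n → ℕ
  indeg v = length (filter (λ e → head e ≟ v) (allFin m))

  data DWalk : Fin n → Fin n → Set where
    []  : ∀ {u} → DWalk u u
    _∷_ : ∀ {w} (e : Fin m) → DWalk (head e) w → DWalk (tail e) w

  arcs : ∀ {u w} → DWalk u w → List (Fin m)
  arcs []      = []
  arcs (e ∷ p) = e ∷ arcs p

  vertices : ∀ {u w} → DWalk u w → List (Fin n)
  vertices {u} []      = u ∷ []
  vertices (e ∷ p) = tail e ∷ vertices p

  DPath : Fin n → Fin n → Set
  DPath u w = ∃ λ (p : DWalk u w) → Unique (vertices p)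

  Acyclic : Set
  Acyclic = ∀ (e : Fin m) (p : DWalk (head e) (tail e)) → ⊥

  Disjoint : List (Fin m) → List (Fin m) → Set
  Disjoint xs ys = ∀ {e} → e ∈ xs → e ∈ ys → ⊥

  ArcDisjointPaths : ℕ → Fin n → Fin n → Set
  ArcDisjointPaths k u w =
    ∃ λ (P : Fin k → DPath u w) →
      ∀ i j → i ≢ j → Disjoint (arcs (proj₁ (P i))) (arcs (proj₁ (P j)))

module _ {n m : ℕ} (G : MultiGraph n m) (s t : Fin n) (k ℓ : ℕ) where

  fb : Fin n → ℕ
  fb v with v ≟ s | v ≟ t
  ... | Relation.Nullary.yes _ | _ = 0
  ... | Relation.Nullary.no _ | Relation.Nullary.yes _ = deg G t
  ... | Relation.Nullary.no _ | Relation.Nullary.no _ = k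

  gb : Fin n → ℕ
  gb v with v ≟ s | v ≟ t
  ... | Relation.Nullary.yes _ | _ = deg G s
  ... | Relation.Nullary.no _ | Relation.Nullary.yes _ = 0
  ... | Relation.Nullary.no _ | Relation.Nullary.no _ = ℓ

module Submission where

open import Defs
open import Data.Nat using (ℕ; suc; _≤_; _<_; _+_; z≤n)
open import Data.Nat.Properties
  using (≤-refl; ≤-reflexive; <-≤-trans; <⇒≱; +-suc; +-assoc; +-identityʳ; +-cancelˡ-≤; +-cancelʳ-≤; +-monoʳ-≤)
open import Data.Fin as Fin using (Fin; toℕ; fromℕ<)
open import Data.Fin.Properties using (_≟_; toℕ<n; toℕ-injective; toℕ-fromℕ<; injective⇒≤; any?)
open import Data.Bool using (true; false)
open import Data.Product using (Σ; ∃; _×_; _,_; proj₁; proj₂; map)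
open import Data.Sum using (_⊎_; inj₁; inj₂; [_,_]; swap)
open import Data.Empty using (⊥; ⊥-elim)
open import Data.List using (List; []; _∷_; length; filter; allFin; lookup)
open import Data.List.Properties using (filter-some; filter-none)
open import Data.List.Membership.Propositional using (_∈_)
open import Data.List.Membership.Propositional.Properties
  using (∈-filter⁺; ∈-filter⁻; ∈-allFin; ∈-lookup)
open import Data.List.Membership.Setoid.Properties using (index-injective)
open import Data.List.Relation.Unary.Any using (here; there)
import Data.List.Relation.Unary.Any as Any
open import Data.List.Relation.Unary.All using (All; []; _∷_)
import Data.List.Relation.Unary.All as All
open import Data.List.Relation.Unary.Unique.Propositional using (Unique)
open import Data.List.Relation.Unary.Unique.Propositional.Properties using (filter⁺; allFin⁺)
open import Data.List.Relation.Unary.AllPairs using ([]; _∷_)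
open import Function using (id; _∘_)
open import Function.Bundles using (_⇔_; mk⇔; Equivalence)
open import Function.Definitions using (Injective)
open import Relation.Binary.PropositionalEquality
  using (_≡_; _≢_; refl; sym; trans; cong; subst; subst₂; setoid; module ≡-Reasoning)
open import Relation.Nullary using (¬_; yes; no; does; ¬?; _⊎-dec_; contradiction)
open import Relation.Nullary.Decidable using (_×-dec_; decidable-stable)
open import Relation.Unary using (Pred; Decidable)

-- Both conditions say that the acyclic orientation has no arc into s, no arc out of t,
-- and indegree ≥ k, outdegree ≥ ℓ at every other vertex.  Arc-disjoint paths ending
-- (starting) at v have distinct last (first) arcs, which gives the degree bounds; if
-- some vertex v₀ ∉ {s, t} exists, s reaches every vertex and every vertex reaches t
-- through v₀, so acyclicity forbids arcs into s and out of t (if V = {s, t}, orient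
-- every edge away from s).  Conversely, enumerate the in-arcs of every vertex; the i-th
-- path to v follows backwards the i-th in-arc of each vertex until it reaches s, which
-- happens since an acyclic walk has fewer than |V| arcs.  Two of these paths share no
-- arc e, because e has a single position among the in-arcs of its head.  Paths to t
-- are built forwards in the same way from out-arcs.

module _ {a} {A : Set a} where

  lookup-injective : ∀ {xs : List A} → Unique xs → ∀ i j → lookup xs i ≡ lookup xs j → i ≡ j
  lookup-injective (_  ∷ _)   Fin.zero    Fin.zero    _  = refl
  lookup-injective (x∉ ∷ _)   Fin.zero    (Fin.suc j) eq = contradiction eq (All.lookup x∉ (∈-lookup j))
  lookup-injective (x∉ ∷ _)   (Fin.suc i) Fin.zero    eq = contradiction (sym eq) (All.lookup x∉ (∈-lookup i))
  lookup-injective (_  ∷ xs!) (Fin.suc i) (Fin.suc j) eq = cong Fin.suc (lookup-injective xs! i j eq)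

  ∈-injective⇒≤-length : ∀ {k} {xs : List A} (f : Fin k → A) →
                         Injective _≡_ _≡_ f → (∀ i → f i ∈ xs) → k ≤ length xs
  ∈-injective⇒≤-length f f-inj f∈ =
    injective⇒≤ (λ {i} {j} eq → f-inj (index-injective (setoid A) (f∈ i) (f∈ j) eq))

  length-filter-⊎ : ∀ {p} {P Q R : Pred A p} (P? : Decidable P) (Q? : Decidable Q) (R? : Decidable R) →
                    (∀ {x} → P x ⇔ (Q x ⊎ R x)) → (∀ {x} → Q x → ¬ R x) → ∀ xs →
                    length (filter P? xs) ≡ length (filter Q? xs) + length (filter R? xs)
  length-filter-⊎ P? Q? R? P⇔Q⊎R Q∩R=∅ [] = refl
  length-filter-⊎ P? Q? R? P⇔Q⊎R Q∩R=∅ (x ∷ xs)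
    with ih ← length-filter-⊎ P? Q? R? P⇔Q⊎R Q∩R=∅ xs | P? x | Q? x | R? x
  ... | _      | yes q  | yes r  = contradiction r (Q∩R=∅ q)
  ... | no ¬p  | yes q  | _      = contradiction (Equivalence.from P⇔Q⊎R (inj₁ q)) ¬p
  ... | no ¬p  | _      | yes r  = contradiction (Equivalence.from P⇔Q⊎R (inj₂ r)) ¬p
  ... | yes p  | no ¬q  | no ¬r  = ⊥-elim ([ ¬q , ¬r ] (Equivalence.to P⇔Q⊎R p))
  ... | yes _  | yes _  | no _   = cong suc ih
  ... | yes _  | no _   | yes _  = trans (cong suc ih) (sym (+-suc _ _))
  ... | no _   | no _   | no _   = ih

  At : List A → ℕ → A → Set a
  At xs r x = ∃ λ (j : Fin (length xs)) → toℕ j ≡ r × lookup xs j ≡ x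

  At⇒∈ : ∀ {xs r x} → At xs r x → x ∈ xs
  At⇒∈ (j , _ , refl) = ∈-lookup j

  At-functional : ∀ {xs r r′ x} → Unique xs → At xs r x → At xs r′ x → r ≡ r′
  At-functional xs! (j , refl , eq) (j′ , refl , eq′) =
    cong toℕ (lookup-injective xs! j j′ (trans eq (sym eq′)))

  lookupAt : ∀ {xs r} → r < length xs → ∃ (At xs r)
  lookupAt {xs} r< = lookup xs (fromℕ< r<) , fromℕ< r< , toℕ-fromℕ< r< , refl

Unique⇒length≤ : ∀ {n} {xs : List (Fin n)} → Unique xs → length xs ≤ n
Unique⇒length≤ {xs = xs} xs! = injective⇒≤ {f = lookup xs} (lookup-injective xs! _ _)

module _ {n m : ℕ} (f : Fin m → Fin n) where

  preimage : Fin n → List (Fin m)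
  preimage v = filter (λ x → f x ≟ v) (allFin m)

  preimage-unique : ∀ v → Unique (preimage v)
  preimage-unique v = filter⁺ (λ x → f x ≟ v) (allFin⁺ m)

  ∈-preimage⁺ : ∀ {v} x → f x ≡ v → x ∈ preimage v
  ∈-preimage⁺ {v} x fx≡v = ∈-filter⁺ (λ x → f x ≟ v) (∈-allFin x) fx≡v

  ∈-preimage⁻ : ∀ {v x} → x ∈ preimage v → f x ≡ v
  ∈-preimage⁻ {v} x∈ = proj₂ (∈-filter⁻ (λ x → f x ≟ v) {xs = allFin m} x∈)

  length-preimage>0 : ∀ {v} x → f x ≡ v → 0 < length (preimage v)
  length-preimage>0 {v} x fx≡v =
    filter-some (λ x → f x ≟ v) (Any.map (λ { refl → fx≡v }) (∈-allFin x))

  length-preimage≡0 : ∀ {v} → (∀ x → f x ≢ v) → length (preimage v) ≡ 0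
  length-preimage≡0 {v} fx≢v = cong length (filter-none (λ x → f x ≟ v) (All.tabulate {xs = allFin m} (λ {x} _ → fx≢v x)))

  Ranked : ℕ → Fin m → Set
  Ranked r x = At (preimage (f x)) r x

  Ranked-functional : ∀ {r r′ x} → Ranked r x → Ranked r′ x → r ≡ r′
  Ranked-functional {x = x} = At-functional (preimage-unique (f x))

  ranked-element : ∀ {r v} → r < length (preimage v) → ∃ λ x → f x ≡ v × Ranked r x
  ranked-element {r} {v} r< with x , at ← lookupAt {xs = preimage v} r< =
    x , fx≡v , subst (λ v → At (preimage v) r x) (sym fx≡v) at
    where
    fx≡v : f x ≡ v
    fx≡v = ∈-preimage⁻ (At⇒∈ at)

module _ {n m : ℕ} (G : MultiGraph n m) where

  awayFrom : Fin n → Orientation m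
  awayFrom r e = does (proj₁ (ends G e) ≟ r)

  tail-awayFrom : ∀ {r} e → Incident G e r → tail G (awayFrom r) e ≡ r
  tail-awayFrom {r} e incident with proj₁ (ends G e) ≟ r | incident
  ... | yes end₁≡r | _            = end₁≡r
  ... | no end₁≢r  | inj₁ end₁≡r  = contradiction end₁≡r end₁≢r
  ... | no _       | inj₂ end₂≡r  = end₂≡r

  head-awayFrom : ∀ {r} e → head G (awayFrom r) e ≢ r
  head-awayFrom {r} e with proj₁ (ends G e) ≟ r
  ... | yes end₁≡r = λ end₂≡r → loopless G e (trans end₁≡r (sym end₂≡r))
  ... | no end₁≢r  = end₁≢r

module _ {n m : ℕ} (G : MultiGraph n m) (o : Orientation m) where

  outdeg : Fin n → ℕ
  outdeg v = length (preimage (tail G o) v)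

  incident⇔head⊎tail : ∀ e {v} → Incident G e v ⇔ (head G o e ≡ v ⊎ tail G o e ≡ v)
  incident⇔head⊎tail e with o e
  ... | true  = mk⇔ swap swap
  ... | false = mk⇔ id id

  head≢tail : ∀ e → head G o e ≢ tail G o e
  head≢tail e with o e
  ... | true  = loopless G e ∘ sym
  ... | false = loopless G e

  deg≡indeg+outdeg : ∀ v → deg G v ≡ indeg G o v + outdeg v
  deg≡indeg+outdeg v =
    length-filter-⊎ (λ e → (proj₁ (ends G e) ≟ v) ⊎-dec (proj₂ (ends G e) ≟ v))
      (λ e → head G o e ≟ v) (λ e → tail G o e ≟ v)
      (incident⇔head⊎tail _) (λ head≡v tail≡v → head≢tail _ (trans head≡v (sym tail≡v)))
      (allFin m)

  all-arcs-leave⇒acyclic : ∀ r → (∀ e → tail G o e ≡ r) → Acyclic G o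
  all-arcs-leave⇒acyclic r leaves e p = no-walk-into-r p head≢r (leaves e)
    where
    head≢r : head G o e ≢ r
    head≢r head≡r = head≢tail e (trans head≡r (sym (leaves e)))
    no-walk-into-r : ∀ {u w} → DWalk G o u w → u ≢ r → w ≡ r → ⊥
    no-walk-into-r []      u≢r w≡r = u≢r w≡r
    no-walk-into-r (f ∷ _) f≢r _   = f≢r (leaves f)

module _ {n m : ℕ} {G : MultiGraph n m} {o : Orientation m} where

  infixr 5 _++ʷ_
  _++ʷ_ : ∀ {u x w} → DWalk G o u x → DWalk G o x w → DWalk G o u w
  []      ++ʷ q = q
  (e ∷ p) ++ʷ q = e ∷ (p ++ʷ q)

  length-arcs-++ʷ : ∀ {u x w} (p : DWalk G o u x) (q : DWalk G o x w) →
                    length (arcs G o (p ++ʷ q)) ≡ length (arcs G o p) + length (arcs G o q)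
  length-arcs-++ʷ []      q = refl
  length-arcs-++ʷ (e ∷ p) q = cong suc (length-arcs-++ʷ p q)

  length-vertices : ∀ {u w} (p : DWalk G o u w) → length (vertices G o p) ≡ suc (length (arcs G o p))
  length-vertices []      = refl
  length-vertices (e ∷ p) = cong suc (length-vertices p)

  prefix : ∀ {u w x} (p : DWalk G o u w) → x ∈ vertices G o p → DWalk G o u x
  prefix []      (here refl) = []
  prefix (e ∷ p) (here refl) = []
  prefix (e ∷ p) (there x∈)  = e ∷ prefix p x∈

  lastArc : ∀ {u w} (p : DWalk G o u w) → u ≢ w → ∃ λ e → e ∈ arcs G o p × head G o e ≡ w
  lastArc []      u≢w = contradiction refl u≢w
  lastArc {w = w} (e ∷ p) _ with head G o e ≟ w
  ... | yes head≡w = e , here refl , head≡w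
  ... | no head≢w  = map id (map there id) (lastArc p head≢w)

  firstArc : ∀ {u w} (p : DWalk G o u w) → u ≢ w → ∃ λ e → e ∈ arcs G o p × tail G o e ≡ u
  firstArc []      u≢w = contradiction refl u≢w
  firstArc (e ∷ p) _   = e , here refl , refl

  somePath : ∀ {k u w} → ArcDisjointPaths G o k u w → 0 < k → DWalk G o u w
  somePath (P , _) 0<k = proj₁ (P (fromℕ< 0<k))

  ArcDisjointPaths⇒≤ : ∀ {k u w} (end : Fin m → Fin n) {x} →
                       (∀ (p : DWalk G o u w) → ∃ λ e → e ∈ arcs G o p × end e ≡ x) →
                       ArcDisjointPaths G o k u w → k ≤ length (preimage end x)
  ArcDisjointPaths⇒≤ {k} end {x} pick (P , disjoint) =
    ∈-injective⇒≤-length chosen chosen-injective (λ i → ∈-preimage⁺ end (chosen i) (end-chosen i))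
    where
    chosen : Fin k → Fin m
    chosen i = proj₁ (pick (proj₁ (P i)))
    chosen-∈ : ∀ i → chosen i ∈ arcs G o (proj₁ (P i))
    chosen-∈ i = proj₁ (proj₂ (pick (proj₁ (P i))))
    end-chosen : ∀ i → end (chosen i) ≡ x
    end-chosen i = proj₂ (proj₂ (pick (proj₁ (P i))))
    chosen-injective : Injective _≡_ _≡_ chosen
    chosen-injective {i} {j} eq with i ≟ j
    ... | yes i≡j = i≡j
    ... | no i≢j  = ⊥-elim (disjoint i j i≢j (chosen-∈ i) (subst (_∈ _) (sym eq) (chosen-∈ j)))

  ArcDisjointPaths⇒≤indeg : ∀ {k u w} → u ≢ w → ArcDisjointPaths G o k u w → k ≤ indeg G o w
  ArcDisjointPaths⇒≤indeg u≢w = ArcDisjointPaths⇒≤ (head G o) (λ p → lastArc p u≢w)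

  ArcDisjointPaths⇒≤outdeg : ∀ {k u w} → u ≢ w → ArcDisjointPaths G o k u w → k ≤ outdeg G o u
  ArcDisjointPaths⇒≤outdeg u≢w = ArcDisjointPaths⇒≤ (tail G o) (λ p → firstArc p u≢w)

  module _ (acyclic : Acyclic G o) where

    acyclic⇒vertices-unique : ∀ {u w} (p : DWalk G o u w) → Unique (vertices G o p)
    acyclic⇒vertices-unique []      = [] ∷ []
    acyclic⇒vertices-unique (e ∷ p) =
      All.tabulate (λ x∈ tail≡x → acyclic e (subst (DWalk G o (head G o e)) (sym tail≡x) (prefix p x∈)))
      ∷ acyclic⇒vertices-unique p

    acyclic⇒length<n : ∀ {u w} (p : DWalk G o u w) → length (arcs G o p) < n
    acyclic⇒length<n p = subst (_≤ n) (length-vertices p) (Unique⇒length≤ (acyclic⇒vertices-unique p))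

    reaches-all⇒no-arc-into : ∀ {r} → (∀ u → DWalk G o r u) → ∀ e → head G o e ≢ r
    reaches-all⇒no-arc-into r⇝ e head≡r =
      acyclic e (subst (λ x → DWalk G o x (tail G o e)) (sym head≡r) (r⇝ (tail G o e)))

    reached-by-all⇒no-arc-out-of : ∀ {r} → (∀ u → DWalk G o u r) → ∀ e → tail G o e ≢ r
    reached-by-all⇒no-arc-out-of ⇝r e tail≡r =
      acyclic e (subst (DWalk G o (head G o e)) (sym tail≡r) (⇝r (head G o e)))

    labelledWalks⇒ArcDisjointPaths :
      ∀ {k u w} (Label : Fin k → Fin m → Set) → (∀ {i j e} → Label i e → Label j e → i ≡ j) →
      (∀ i → Σ (DWalk G o u w) (λ p → All (Label i) (arcs G o p))) → ArcDisjointPaths G o k u w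
    labelledWalks⇒ArcDisjointPaths Label label-functional W =
      (λ i → proj₁ (W i) , acyclic⇒vertices-unique (proj₁ (W i))) ,
      (λ i j i≢j e∈i e∈j →
        i≢j (label-functional (All.lookup (proj₂ (W i)) e∈i) (All.lookup (proj₂ (W j)) e∈j)))

    -- The fuel is the number of arcs the walk may still gain; acyclicity bounds the total by n.
    module _ (X : Fin n → Set) (Good : Fin m → Set) where

      greedyWalkFrom : ∀ {s} → (∀ {x} → X x → x ≢ s → ∃ λ e → head G o e ≡ x × Good e × X (tail G o e)) →
                       ∀ {v} → X v → Σ (DWalk G o s v) (λ p → All Good (arcs G o p))
      greedyWalkFrom {s} inArc {v} Xv = extend n Xv [] [] ≤-refl
        where
        extend : ∀ fuel {x} → X x → (q : DWalk G o x v) → All Good (arcs G o q) →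
                 n ≤ length (arcs G o q) + fuel → Σ (DWalk G o s v) (λ p → All Good (arcs G o p))
        extend fuel {x} Xx q good bound with x ≟ s
        ... | yes refl = q , good
        extend 0 Xx q good bound | no _ =
          contradiction (subst (n ≤_) (+-identityʳ _) bound) (<⇒≱ (acyclic⇒length<n q))
        extend (suc fuel) Xx q good bound | no x≢s with inArc Xx x≢s
        ... | e , refl , good-e , X-tail =
          extend fuel X-tail (e ∷ q) (good-e ∷ good) (subst (n ≤_) (+-suc _ fuel) bound)

      greedyWalkTo : ∀ {t} → (∀ {x} → X x → x ≢ t → ∃ λ e → tail G o e ≡ x × Good e × X (head G o e)) →
                     ∀ {v} → X v → Σ (DWalk G o v t) (λ p → All Good (arcs G o p))
      greedyWalkTo {t} outArc {v} Xv = extend n Xv [] ≤-refl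
        where
        extend : ∀ fuel {x} → X x → (p : DWalk G o v x) →
                 n ≤ length (arcs G o p) + fuel → Σ (DWalk G o x t) (λ q → All Good (arcs G o q))
        extend fuel {x} Xx p bound with x ≟ t
        ... | yes refl = [] , []
        extend 0 Xx p bound | no _ =
          contradiction (subst (n ≤_) (+-identityʳ _) bound) (<⇒≱ (acyclic⇒length<n p))
        extend (suc fuel) Xx p bound | no x≢t with outArc Xx x≢t
        ... | e , refl , good-e , X-head =
          map (e ∷_) (good-e ∷_) (extend fuel X-head (p ++ʷ e ∷ []) bound′)
          where
          bound′ : n ≤ length (arcs G o (p ++ʷ e ∷ [])) + fuel
          bound′ = subst (n ≤_) (sym (trans (cong (_+ fuel) (length-arcs-++ʷ p (e ∷ []))) (+-assoc _ 1 fuel))) bound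

module StOrientation {n m : ℕ} (G : MultiGraph n m) (s t : Fin n) (k ℓ : ℕ) where

  open ≡-Reasoning

  Paths : Orientation m → Set
  Paths o = ∀ v → v ≢ s → v ≢ t → ArcDisjointPaths G o k s v × ArcDisjointPaths G o ℓ v t

  DegreeBounds : Orientation m → Set
  DegreeBounds o = ∀ v → fb G s t k ℓ v ≤ indeg G o v × indeg G o v + gb G s t k ℓ v ≤ deg G v

  record StBounded (o : Orientation m) : Set where
    field
      no-arc-into-s   : ∀ e → head G o e ≢ s
      no-arc-out-of-t : ∀ e → tail G o e ≢ t
      k≤indeg         : ∀ v → v ≢ s → v ≢ t → k ≤ indeg G o v
      ℓ≤outdeg        : ∀ v → v ≢ s → v ≢ t → ℓ ≤ outdeg G o v

  fb-gb-at-s : fb G s t k ℓ s ≡ 0 × gb G s t k ℓ s ≡ deg G s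
  fb-gb-at-s with s ≟ s
  ... | yes _   = refl , refl
  ... | no s≢s  = contradiction refl s≢s

  fb-gb-at-t : s ≢ t → fb G s t k ℓ t ≡ deg G t × gb G s t k ℓ t ≡ 0
  fb-gb-at-t s≢t with t ≟ s | t ≟ t
  ... | yes t≡s | _       = contradiction (sym t≡s) s≢t
  ... | no _    | yes _   = refl , refl
  ... | no _    | no t≢t  = contradiction refl t≢t

  fb-gb-inner : ∀ {v} → v ≢ s → v ≢ t → fb G s t k ℓ v ≡ k × gb G s t k ℓ v ≡ ℓ
  fb-gb-inner {v} v≢s v≢t with v ≟ s | v ≟ t
  ... | yes v≡s | _       = contradiction v≡s v≢s
  ... | no _    | yes v≡t = contradiction v≡t v≢t
  ... | no _    | no _    = refl , refl

  module _ {o : Orientation m} where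

    DegreeBounds⇒StBounded : s ≢ t → DegreeBounds o → StBounded o
    DegreeBounds⇒StBounded s≢t bounds = record
      { no-arc-into-s   = λ e head≡s → <⇒≱ (length-preimage>0 (head G o) e head≡s) indeg-s≤0
      ; no-arc-out-of-t = λ e tail≡t → <⇒≱ (length-preimage>0 (tail G o) e tail≡t) outdeg-t≤0
      ; k≤indeg         = λ v v≢s v≢t →
          subst (_≤ indeg G o v) (proj₁ (fb-gb-inner v≢s v≢t)) (proj₁ (bounds v))
      ; ℓ≤outdeg        = λ v v≢s v≢t → +-cancelˡ-≤ (indeg G o v) _ _
          (subst₂ (λ g d → indeg G o v + g ≤ d)
            (proj₂ (fb-gb-inner v≢s v≢t)) (deg≡indeg+outdeg G o v) (proj₂ (bounds v)))
      }
      where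
      indeg-s≤0 : indeg G o s ≤ 0
      indeg-s≤0 = +-cancelʳ-≤ (deg G s) (indeg G o s) 0
        (subst (λ g → indeg G o s + g ≤ deg G s) (proj₂ fb-gb-at-s) (proj₂ (bounds s)))
      outdeg-t≤0 : outdeg G o t ≤ 0
      outdeg-t≤0 = +-cancelˡ-≤ (indeg G o t) (outdeg G o t) 0
        (subst₂ _≤_ (trans (proj₁ (fb-gb-at-t s≢t)) (deg≡indeg+outdeg G o t)) (sym (+-identityʳ _))
          (proj₁ (bounds t)))

    -- Matching on v ≟ s and v ≟ t also evaluates fb and gb at v.
    StBounded⇒DegreeBounds : StBounded o → DegreeBounds o
    StBounded⇒DegreeBounds b v with v ≟ s | v ≟ t
    ... | yes refl | _        = z≤n , subst (λ i → i + deg G s ≤ deg G s) (sym indeg-s≡0) ≤-refl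
      where
      indeg-s≡0 : indeg G o s ≡ 0
      indeg-s≡0 = length-preimage≡0 (head G o) (StBounded.no-arc-into-s b)
    ... | no _     | yes refl = ≤-reflexive deg≡indeg , ≤-reflexive (trans (+-identityʳ _) (sym deg≡indeg))
      where
      deg≡indeg : deg G t ≡ indeg G o t
      deg≡indeg = begin
        deg G t                    ≡⟨ deg≡indeg+outdeg G o t ⟩
        indeg G o t + outdeg G o t ≡⟨ cong (indeg G o t +_) (length-preimage≡0 (tail G o) (StBounded.no-arc-out-of-t b)) ⟩
        indeg G o t + 0            ≡⟨ +-identityʳ _ ⟩
        indeg G o t                ∎
    ... | no v≢s   | no v≢t   =
      StBounded.k≤indeg b v v≢s v≢t ,
      subst (indeg G o v + ℓ ≤_) (sym (deg≡indeg+outdeg G o v)) (+-monoʳ-≤ (indeg G o v) (StBounded.ℓ≤outdeg b v v≢s v≢t))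

    Paths⇒StBounded : Acyclic G o → 0 < k → 0 < ℓ → Paths o →
                      ∀ v₀ → v₀ ≢ s → v₀ ≢ t → StBounded o
    Paths⇒StBounded acyclic 0<k 0<ℓ paths v₀ v₀≢s v₀≢t = record
      { no-arc-into-s   = reaches-all⇒no-arc-into acyclic s⇝
      ; no-arc-out-of-t = reached-by-all⇒no-arc-out-of acyclic ⇝t
      ; k≤indeg         = λ v v≢s v≢t → ArcDisjointPaths⇒≤indeg (v≢s ∘ sym) (proj₁ (paths v v≢s v≢t))
      ; ℓ≤outdeg        = λ v v≢s v≢t → ArcDisjointPaths⇒≤outdeg v≢t (proj₂ (paths v v≢s v≢t))
      }
      where
      s⇝t : DWalk G o s t
      s⇝t = somePath (proj₁ (paths v₀ v₀≢s v₀≢t)) 0<k ++ʷ somePath (proj₂ (paths v₀ v₀≢s v₀≢t)) 0<ℓ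
      s⇝ : ∀ u → DWalk G o s u
      s⇝ u with u ≟ s | u ≟ t
      ... | yes refl | _        = []
      ... | no _     | yes refl = s⇝t
      ... | no u≢s   | no u≢t   = somePath (proj₁ (paths u u≢s u≢t)) 0<k
      ⇝t : ∀ u → DWalk G o u t
      ⇝t u with u ≟ s | u ≟ t
      ... | yes refl | _        = s⇝t
      ... | no _     | yes refl = []
      ... | no u≢s   | no u≢t   = somePath (proj₂ (paths u u≢s u≢t)) 0<ℓ

    StBounded⇒Paths : Acyclic G o → StBounded o → Paths o
    StBounded⇒Paths acyclic b v v≢s v≢t =
      labelledWalks⇒ArcDisjointPaths acyclic (InRank ∘ toℕ) rank-injective
        (λ i → greedyWalkFrom acyclic (_≢ t) (InRank (toℕ i)) (inArc i) v≢t) ,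
      labelledWalks⇒ArcDisjointPaths acyclic (OutRank ∘ toℕ) rank-injective
        (λ i → greedyWalkTo acyclic (_≢ s) (OutRank (toℕ i)) (outArc i) v≢s)
      where
      open StBounded b
      InRank OutRank : ℕ → Fin m → Set
      InRank = Ranked (head G o)
      OutRank = Ranked (tail G o)
      rank-injective : ∀ {end : Fin m → Fin n} {c} {i j : Fin c} {e} →
                       Ranked end (toℕ i) e → Ranked end (toℕ j) e → i ≡ j
      rank-injective {end} i-th j-th = toℕ-injective (Ranked-functional end i-th j-th)
      inArc : (i : Fin k) → ∀ {x} → x ≢ t → x ≢ s →
              ∃ λ e → head G o e ≡ x × InRank (toℕ i) e × tail G o e ≢ t
      inArc i {x} x≢t x≢s with e , head≡x , i-th ←
        ranked-element (head G o) (<-≤-trans (toℕ<n i) (k≤indeg x x≢s x≢t)) =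
        e , head≡x , i-th , no-arc-out-of-t e
      outArc : (i : Fin ℓ) → ∀ {x} → x ≢ s → x ≢ t →
               ∃ λ e → tail G o e ≡ x × OutRank (toℕ i) e × head G o e ≢ s
      outArc i {x} x≢s x≢t with e , tail≡x , i-th ←
        ranked-element (tail G o) (<-≤-trans (toℕ<n i) (ℓ≤outdeg x x≢s x≢t)) =
        e , tail≡x , i-th , no-arc-into-s e

  module _ (s≢t : s ≢ t) (no-inner : ∀ v → v ≢ s → v ≢ t → ⊥) where

    incident-to-s : ∀ e → Incident G e s
    incident-to-s e with proj₁ (ends G e) ≟ s | proj₂ (ends G e) ≟ s
    ... | yes end₁≡s | _          = inj₁ end₁≡s
    ... | no _       | yes end₂≡s = inj₂ end₂≡s
    ... | no end₁≢s  | no end₂≢s  = ⊥-elim (loopless G e (trans (≡t end₁≢s) (sym (≡t end₂≢s))))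
      where
      ≡t : ∀ {x} → x ≢ s → x ≡ t
      ≡t {x} x≢s = decidable-stable (x ≟ t) (no-inner x x≢s)

    tail-awayFrom-s : ∀ e → tail G (awayFrom G s) e ≡ s
    tail-awayFrom-s e = tail-awayFrom G e (incident-to-s e)

    awayFrom-acyclic : Acyclic G (awayFrom G s)
    awayFrom-acyclic = all-arcs-leave⇒acyclic G (awayFrom G s) s tail-awayFrom-s

    awayFrom-StBounded : StBounded (awayFrom G s)
    awayFrom-StBounded = record
      { no-arc-into-s   = head-awayFrom G
      ; no-arc-out-of-t = λ e tail≡t → s≢t (trans (sym (tail-awayFrom-s e)) tail≡t)
      ; k≤indeg         = λ v v≢s v≢t → ⊥-elim (no-inner v v≢s v≢t)
      ; ℓ≤outdeg        = λ v v≢s v≢t → ⊥-elim (no-inner v v≢s v≢t)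
      }

claim1 : ∀ {n m} (G : MultiGraph n m) → Connected G →
    (s t : Fin n) → s ≢ t → (k ℓ : ℕ) → 1 ≤ k → 1 ≤ ℓ →
    (∃ λ (o : Orientation m) → Acyclic G o ×
       (∀ v → v ≢ s → v ≢ t →
          ArcDisjointPaths G o k s v × ArcDisjointPaths G o ℓ v t))
    ⇔
    (∃ λ (o : Orientation m) → Acyclic G o ×
       (∀ v → fb G s t k ℓ v ≤ indeg G o v × indeg G o v + gb G s t k ℓ v ≤ deg G v))
claim1 {m = m} G _ s t s≢t k ℓ 0<k 0<ℓ = mk⇔ paths⇒bounds bounds⇒paths
  where
  open StOrientation G s t k ℓ

  AcyclicWith : (Orientation m → Set) → Set
  AcyclicWith Property = ∃ λ o → Acyclic G o × Property o

  paths⇒bounds : AcyclicWith Paths → AcyclicWith DegreeBounds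
  paths⇒bounds (o , acyclic , paths) with any? (λ v → ¬? (v ≟ s) ×-dec ¬? (v ≟ t))
  ... | yes (v₀ , v₀≢s , v₀≢t) =
    o , acyclic , StBounded⇒DegreeBounds (Paths⇒StBounded acyclic 0<k 0<ℓ paths v₀ v₀≢s v₀≢t)
  ... | no ∄inner =
    awayFrom G s , awayFrom-acyclic s≢t no-inner ,
    StBounded⇒DegreeBounds (awayFrom-StBounded s≢t no-inner)
    where
    no-inner : ∀ v → v ≢ s → v ≢ t → ⊥
    no-inner v v≢s v≢t = ∄inner (v , v≢s , v≢t)

  bounds⇒paths : AcyclicWith DegreeBounds → AcyclicWith Paths
  bounds⇒paths (o , acyclic , bounds) =
    o , acyclic , StBounded⇒Paths acyclic (DegreeBounds⇒StBounded s≢t bounds)
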